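{- Let $p,t$ be positive integers, let $n_1,\dots,n_p$ be positive integers, let $X=[n]$ with $n=n_1+\cdots+n_p$, partitioned into consecutive blocks $X_1=[n_1]$ and $X_i=\left[\sum_{j\le i}n_j\right]\setminus\left[\sum_{j\le i-1}n_j\right]$ for $i=2,\dots,p$. Let $\mathcal{R}\subset(\mathbb{Z}^+)^p$ be a non-empty finite set, let $$\mathcal{H}_2=\bigcup_{(r_1,\dots,r_p)\in\mathcal{R}}\left\{F\subset X:|F\cap X_i|=r_i,\ i=1,\dots,p\right\},$$ for each $i\in[p]$ let $b_i=\max_{(r_1,\dots,r_p)\in\mathcal{R}}r_i$, and assume $n_i>2(t+1)b_i$ for every $i\in[p]$. Let $K=\bigcup_{i=1}^pQ_i(2b_i-1)$ and, for a non-empty $\mathcal{F}\subset\mathcal{H}_2$, let $\alpha(\mathcal{F})=\min_{F\in\mathcal{F}}|F\cap K|$. Suppose $\mathcal{F}\subset\mathcal{H}_2$ is a non-empty $t$-intersecting family that is $l$-shifted for every $l\in[p]$, and $\alpha(\mathcal{F})=t$. Then $$|\mathcal{F}|\le\max_{\substack{t_1+\cdots+t_p=t\\ t_1,\dots,t_p\in\mathbb{N}}}\sum_{(r_1,\dots,r_p)\in\mathcal{R}}\prod_{i\in[p]}\binom{n_i-t_i}{r_i-t_i},$$ and if equality holds then $\mathcal{F}$ is a full $t$-star in $\mathcal{H}_2$.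
   Context: $\mathbb{N}$ denotes the non-negative integers and $\binom{a}{b}=0$ if $b<0$ or $b>a$. A family is $t$-intersecting if any two members share at least $t$ elements. For $i,j\in X$ and $F\subset X$, $\delta_{i,j}(F)=(F\setminus\{j\})\cup\{i\}$ if $j\in F$, $i\notin F$, and $\delta_{i,j}(F)=F$ otherwise; $\Delta_{i,j}(\mathcal{F})=\{\delta_{i,j}(F):F\in\mathcal{F}\}\cup\{F\in\mathcal{F}:\delta_{i,j}(F)\in\mathcal{F}\}$. $\mathcal{F}$ is $l$-shifted if $\Delta_{i,j}(\mathcal{F})=\mathcal{F}$ for all $i,j\in X_l$ with $i<j$. $Q_l(s)$ denotes the set of the $s$ smallest elements of $X_l$. A subfamily $\mathcal{F}\subset\mathcal{H}_2$ is a full $t$-star in $\mathcal{H}_2$ if $\mathcal{F}=\{F\in\mathcal{H}_2:T\subset F\}$ for some $t$-subset $T\subset X$. -}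

module Defs where

open import Data.Nat using (ℕ; zero; suc; _+_; _*_; _∸_; _≤_; _<_; _≤ᵇ_; _<ᵇ_; _⊔_; _⊓_)
open import Data.Nat.Combinatorics using (_C_)
open import Data.Nat.ListAction using (sum; product)
open import Data.Bool using (Bool; true; false; _∧_; not; if_then_else_)
open import Data.Fin using (Fin; zero; suc; toℕ)
open import Data.Vec using (Vec; []; _∷_; lookup; tabulate; _[_]≔_)
import Data.Vec as Vec
open import Data.List using (List; []; _∷_; map; allFin; foldr)
import Data.List as List
open import Data.Fin.Subset using (Subset; ⋃; ∣_∣; _∩_; _⊆_; inside; outside)
open import Data.List.Membership.Propositional using (_∈_)
open import Data.Product using (Σ; _×_; ∃; ∃-syntax)
open import Data.Sum using (_⊎_)
open import Relation.Binary.PropositionalEquality using (_≡_)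
open import Function.Bundles using (_⇔_)

-- Ground set X = [n] is modelled as Fin n with n = n₁ + ⋯ + n_p,
-- the block sizes being given by ns : Vec ℕ p.

-- psum ns i = n₁ + ⋯ + n_{i} (sum of the sizes of the blocks before block i,
-- 0-indexed), i.e. the offset of block i.
psum : ∀ {p} → Vec ℕ p → Fin p → ℕ
psum (a ∷ as) zero    = 0
psum (a ∷ as) (suc i) = a + psum as i

inBlock : ∀ {p} (ns : Vec ℕ p) → Fin p → Fin (Vec.sum ns) → Set
inBlock ns l x = (psum ns l ≤ toℕ x) × (toℕ x < psum ns l + lookup ns l)

block : ∀ {p} (ns : Vec ℕ p) → Fin p → Subset (Vec.sum ns)
block ns l = tabulate λ x → (psum ns l ≤ᵇ toℕ x) ∧ (toℕ x <ᵇ psum ns l + lookup ns l)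

-- Q_l(s): the s smallest elements of X_l (for s ≤ n_l).
Q : ∀ {p} (ns : Vec ℕ p) → Fin p → ℕ → Subset (Vec.sum ns)
Q ns l s = tabulate λ x → (psum ns l ≤ᵇ toℕ x) ∧ (toℕ x <ᵇ psum ns l + s)

InH2 : ∀ {p} (ns : Vec ℕ p) → List (Vec ℕ p) → Subset (Vec.sum ns) → Set
InH2 ns R F = ∃[ r ] (r ∈ R × (∀ i → ∣ F ∩ block ns i ∣ ≡ lookup r i))

bmax : ∀ {p} → List (Vec ℕ p) → Fin p → ℕ
bmax R i = foldr (λ r m → lookup r i ⊔ m) 0 R

K : ∀ {p} (ns : Vec ℕ p) → List (Vec ℕ p) → Subset (Vec.sum ns)
K {p} ns R = ⋃ (map (λ i → Q ns i (2 * bmax R i ∸ 1)) (allFin p))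

-- α(𝓕) = min_{F ∈ 𝓕} |F ∩ K|  (only meaningful for non-empty 𝓕)
alpha : ∀ {p} (ns : Vec ℕ p) → List (Vec ℕ p) → List (Subset (Vec.sum ns)) → ℕ
alpha ns R []      = 0
alpha ns R (F ∷ 𝓕) = foldr (λ G m → ∣ G ∩ K ns R ∣ ⊓ m) ∣ F ∩ K ns R ∣ 𝓕

TIntersecting : ∀ {n} → ℕ → List (Subset n) → Set
TIntersecting t 𝓕 = ∀ {A B} → A ∈ 𝓕 → B ∈ 𝓕 → t ≤ ∣ A ∩ B ∣

δ : ∀ {n} → Fin n → Fin n → Subset n → Subset n
δ i j F = if lookup F j ∧ not (lookup F i)
          then ((F [ j ]≔ outside) [ i ]≔ inside)
          else F

InΔ : ∀ {n} → Fin n → Fin n → List (Subset n) → Subset n → Set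
InΔ i j 𝓕 G = (∃[ F ] (F ∈ 𝓕 × δ i j F ≡ G)) ⊎ (G ∈ 𝓕 × δ i j G ∈ 𝓕)

LShifted : ∀ {p} (ns : Vec ℕ p) → Fin p → List (Subset (Vec.sum ns)) → Set
LShifted ns l 𝓕 = ∀ i j → inBlock ns l i → inBlock ns l j → toℕ i < toℕ j →
                  ∀ G → (InΔ i j 𝓕 G ⇔ G ∈ 𝓕)

-- binom(a − c, b − c) with the convention binom(x, y) = 0 for y < 0 (i.e. c > b)
binomShift : ℕ → ℕ → ℕ → ℕ
binomShift a b c = if c ≤ᵇ b then (a ∸ c) C (b ∸ c) else 0

boundTerm : ∀ {p} → Vec ℕ p → List (Vec ℕ p) → Vec ℕ p → ℕ
boundTerm {p} ns R ts =
  sum (map (λ r → product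
    (List.tabulate {n = p} λ i → binomShift (lookup ns i) (lookup r i) (lookup ts i))) R)

IsMaxBound : ∀ {p} → Vec ℕ p → List (Vec ℕ p) → ℕ → ℕ → Set
IsMaxBound ns R t M =
  (∃[ ts ] (Vec.sum ts ≡ t × boundTerm ns R ts ≡ M)) ×
  (∀ ts → Vec.sum ts ≡ t → boundTerm ns R ts ≤ M)

FullStar : ∀ {p} (ns : Vec ℕ p) → List (Vec ℕ p) → ℕ → List (Subset (Vec.sum ns)) → Set
FullStar ns R t 𝓕 = ∃[ T ] (∣ T ∣ ≡ t × (∀ G → (G ∈ 𝓕 ⇔ (InH2 ns R G × T ⊆ G))))

-- Let F₀ ∈ 𝓕 attain α(𝓕) = t and put T = F₀ ∩ K, so |T| = t, and D = F₀ ∖ K.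
-- Every G ∈ 𝓕 contains T, by induction on |G ∩ D|.  If G ∩ D = ∅ then
-- t ≤ |G ∩ F₀| = |G ∩ T| forces T ⊆ G.  Otherwise pick j ∈ G ∩ D, say in block l,
-- and let Q = Q_l(2b_l − 1).  As j ∉ K, j lies in X_l beyond Q, so F₀ and G each
-- meet Q in at most b_l − 1 points and some i ∈ Q avoids both.  Then i < j, and
-- shiftedness gives δ_{i,j}(G) ∈ 𝓕, which has fewer points in D and agrees with G
-- on F₀ ∖ {j}.  So 𝓕 lies in the star {G ∈ H₂ : T ⊆ G}, which has exactly
-- Σ_r Π_i binom(n_i − t_i, r_i − t_i) members for t_i = |T ∩ X_i|, a bound at
-- most M; equality of sizes forces 𝓕 to be the whole star.
module Submission where

open import Defs
open import Data.Nat using (ℕ; _+_; _*_; _≤_; _<_)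
open import Data.Vec using (Vec; lookup)
import Data.Vec as Vec
open import Data.List using (List; []; length)
open import Data.List.Membership.Propositional using (_∈_)
open import Data.List.Relation.Unary.Unique.Propositional using (Unique)
open import Data.Fin using (Fin)
open import Data.Fin.Subset using (Subset)
open import Data.Product using (_×_)
open import Relation.Binary.PropositionalEquality using (_≡_; _≢_)

open import Data.Bool using (Bool; true; false; _∧_; _∨_; if_then_else_; T)
import Data.Bool.Properties as Bool
open import Data.Fin using (zero; suc; toℕ)
import Data.Fin.Properties as Fin
open import Data.Fin.Subset
  using (Side; inside; outside; ∣_∣; _∩_; _∪_; ∁; ⋃; _⊆_; _⊂_; Nonempty)
  renaming (_∈_ to _∈ₛ_; _∉_ to _∉ₛ_)
open import Data.Fin.Subset.Properties
  using (_∈?_; _⊆?_; nonempty?; Empty-unique; ∣⊥∣≡0; ∣p∣≤n; p⊂q⇒∣p∣<∣q∣; p∩q⊆q;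
         x∈p∩q⁺; x∈p∩q⁻; x∈p∪q⁺; x∈∁p⇒x∉p; p⊆p∪q; q⊆p∪q; ∩-assoc; ∩-distribˡ-∪)
open import Data.List using (_∷_; foldr)
open import Data.Bool.ListAction using (any)
import Data.List as List
open import Data.List.Membership.Propositional.Properties using (∈-map⁺; ∈-allFin)
open import Data.List.Relation.Unary.All as All using (_∷_)
open import Data.List.Relation.Unary.Any as Any using (here; there)
open import Data.List.Relation.Unary.Any.Properties using (any⁺; any⁻)
open import Data.List.Relation.Unary.AllPairs using ([]; _∷_)
open import Data.Nat
  using (zero; suc; _∸_; _≤ᵇ_; _<ᵇ_; _≡ᵇ_; _⊓_; z≤n; s≤s; z<s; _<?_; _≤?_; _≟_)
open import Data.Nat.Combinatorics using (_C_; nCk+nC[k+1]≡[n+1]C[k+1])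
open import Data.Nat.Induction using (<-rec)
open import Data.Nat.ListAction using (product)
open import Data.Nat.Properties
open import Algebra.Properties.CommutativeSemigroup +-commutativeSemigroup using (interchange)
open import Data.Product using (_,_; proj₁; proj₂; ∃-syntax)
import Data.Product as Product
open import Data.Sum using (inj₁; inj₂)
open import Data.Vec using ([]; _∷_; tabulate; take; drop; _[_]≔_)
open import Data.Vec.Properties
  using (lookup∘tabulate; tabulate-cong; tabulate∘lookup; lookup∘update; lookup∘update′;
         []=⇒lookup; lookup⇒[]=)
open import Data.Empty using (⊥; ⊥-elim)
open import Function using (_∘_; _⇔_; case_of_)
open import Function.Bundles using (Equivalence; mk⇔)
open import Relation.Nullary using (Dec; yes; no; does; contradiction)
open import Relation.Binary.PropositionalEquality
  using (refl; sym; trans; cong; cong₂; subst; module ≡-Reasoning)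

private
  variable
    n m p : ℕ

T-does⁺ : ∀ {A : Set} (a? : Dec A) → A → T (does a?)
T-does⁺ (yes _)  _ = _
T-does⁺ (no ¬a) a = ¬a a

∈-tabulate⇔ : ∀ {f : Fin n → Bool} {x} → x ∈ₛ tabulate f ⇔ T (f x)
∈-tabulate⇔ {f = f} {x} = mk⇔
  (λ x∈ → Equivalence.from Bool.T-≡ (trans (sym (lookup∘tabulate f x)) ([]=⇒lookup x∈)))
  (λ fx → lookup⇒[]= x _ (trans (lookup∘tabulate f x) (Equivalence.to Bool.T-≡ fx)))

∈-[]≔⁻ : ∀ {x i} {p : Subset n} {s} → x ≢ i → x ∈ₛ p [ i ]≔ s → x ∈ₛ p
∈-[]≔⁻ {x = x} {p = p} x≢i x∈ =
  lookup⇒[]= x p (trans (sym (lookup∘update′ x≢i p _)) ([]=⇒lookup x∈))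

∉-[]≔outside : ∀ {i} {p : Subset n} → i ∉ₛ p [ i ]≔ outside
∉-[]≔outside {i = i} {p} i∈ = case trans (sym (lookup∘update i p outside)) ([]=⇒lookup i∈) of λ ()

∈-[]≔outside⁻ : ∀ {x j} {p : Subset n} → x ∈ₛ p [ j ]≔ outside → x ∈ₛ p
∈-[]≔outside⁻ {x = x} {j} x∈ with x Fin.≟ j
... | yes refl = contradiction x∈ ∉-[]≔outside
... | no x≢j   = ∈-[]≔⁻ x≢j x∈

∉⇒lookup≡outside : ∀ {x} {p : Subset n} → x ∉ₛ p → lookup p x ≡ outside
∉⇒lookup≡outside {x = x} {p} x∉p with lookup p x in eq
... | inside  = contradiction (lookup⇒[]= x p eq) x∉p
... | outside = refl

0<∣p∣⇒Nonempty : ∀ {p : Subset n} → 0 < ∣ p ∣ → Nonempty p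
0<∣p∣⇒Nonempty {p = inside  ∷ p} _       = zero , Vec.here
0<∣p∣⇒Nonempty {p = outside ∷ p} 0<∣p∣ = Product.map suc Vec.there (0<∣p∣⇒Nonempty 0<∣p∣)

∣p∣≡∣p∩q∣+∣p∩∁q∣ : ∀ (p q : Subset n) → ∣ p ∣ ≡ ∣ p ∩ q ∣ + ∣ p ∩ ∁ q ∣
∣p∣≡∣p∩q∣+∣p∩∁q∣ []            []            = refl
∣p∣≡∣p∩q∣+∣p∩∁q∣ (inside  ∷ p) (inside  ∷ q) = cong suc (∣p∣≡∣p∩q∣+∣p∩∁q∣ p q)
∣p∣≡∣p∩q∣+∣p∩∁q∣ (inside  ∷ p) (outside ∷ q) =
  trans (cong suc (∣p∣≡∣p∩q∣+∣p∩∁q∣ p q)) (sym (+-suc _ _))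
∣p∣≡∣p∩q∣+∣p∩∁q∣ (outside ∷ p) (_       ∷ q) = ∣p∣≡∣p∩q∣+∣p∩∁q∣ p q

∣p∪q∣≤∣p∣+∣q∣ : ∀ (p q : Subset n) → ∣ p ∪ q ∣ ≤ ∣ p ∣ + ∣ q ∣
∣p∪q∣≤∣p∣+∣q∣ []            []            = z≤n
∣p∪q∣≤∣p∣+∣q∣ (inside  ∷ p) (inside  ∷ q) =
  s≤s (≤-trans (∣p∪q∣≤∣p∣+∣q∣ p q) (+-monoʳ-≤ ∣ p ∣ (n≤1+n ∣ q ∣)))
∣p∪q∣≤∣p∣+∣q∣ (inside  ∷ p) (outside ∷ q) = s≤s (∣p∪q∣≤∣p∣+∣q∣ p q)
∣p∪q∣≤∣p∣+∣q∣ (outside ∷ p) (inside  ∷ q) =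
  subst (suc ∣ p ∪ q ∣ ≤_) (sym (+-suc ∣ p ∣ ∣ q ∣)) (s≤s (∣p∪q∣≤∣p∣+∣q∣ p q))
∣p∪q∣≤∣p∣+∣q∣ (outside ∷ p) (outside ∷ q) = ∣p∪q∣≤∣p∣+∣q∣ p q

∣q∣≤∣p∩q∣⇒q⊆p : ∀ {p q : Subset n} → ∣ q ∣ ≤ ∣ p ∩ q ∣ → q ⊆ p
∣q∣≤∣p∩q∣⇒q⊆p {p = p} {q} ∣q∣≤∣p∩q∣ {x} x∈q with x ∈? p
... | yes x∈p = x∈p
... | no  x∉p = contradiction ∣q∣≤∣p∩q∣
  (<⇒≱ (p⊂q⇒∣p∣<∣q∣ (p∩q⊆q p q , x , x∈q , x∉p ∘ proj₁ ∘ x∈p∩q⁻ p q)))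

⊆-⋃ : ∀ {p : Subset n} {ps} → p ∈ ps → p ⊆ ⋃ ps
⊆-⋃ {ps = q ∷ ps} (here refl) = p⊆p∪q (⋃ ps)
⊆-⋃ {ps = q ∷ ps} (there p∈)  = q⊆p∪q q (⋃ ps) ∘ ⊆-⋃ p∈

∣p∣≡∣take∣+∣drop∣ : ∀ n (p : Subset (n + m)) → ∣ p ∣ ≡ ∣ take n p ∣ + ∣ drop n p ∣
∣p∣≡∣take∣+∣drop∣ zero    p             = refl
∣p∣≡∣take∣+∣drop∣ (suc n) (inside  ∷ p) = cong suc (∣p∣≡∣take∣+∣drop∣ n p)
∣p∣≡∣take∣+∣drop∣ (suc n) (outside ∷ p) = ∣p∣≡∣take∣+∣drop∣ n p

-- Intervals; block ns l and Q ns l s unfold to intervals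

interval : ℕ → ℕ → Subset n
interval a b = tabulate λ x → (a ≤ᵇ toℕ x) ∧ (toℕ x <ᵇ b)

∈-interval⁻ : ∀ a b {x : Fin n} → x ∈ₛ interval a b → a ≤ toℕ x × toℕ x < b
∈-interval⁻ a b x∈ =
  let a≤x , x<b = Equivalence.to Bool.T-∧ (Equivalence.to ∈-tabulate⇔ x∈)
  in ≤ᵇ⇒≤ a _ a≤x , <ᵇ⇒< _ b x<b

∈-interval⁺ : ∀ a b {x : Fin n} → a ≤ toℕ x → toℕ x < b → x ∈ₛ interval a b
∈-interval⁺ a b a≤x x<b =
  Equivalence.from ∈-tabulate⇔ (Equivalence.from Bool.T-∧ (≤⇒≤ᵇ a≤x , <⇒<ᵇ x<b))

interval-⊆ : ∀ a {b c} → b ≤ c → interval {n} a b ⊆ interval a c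
interval-⊆ a {b} b≤c x∈ = let a≤x , x<b = ∈-interval⁻ a b x∈ in
  ∈-interval⁺ a _ a≤x (<-≤-trans x<b b≤c)

<ᵇ-suc : ∀ a k → (a <ᵇ suc k) ≡ (a ≤ᵇ k)
<ᵇ-suc zero    k = refl
<ᵇ-suc (suc a) k = refl

interval-suc : ∀ a b → interval {suc n} (suc a) (suc b) ≡ outside ∷ interval a b
interval-suc a b = cong (outside ∷_) (tabulate-cong λ x → cong (_∧ _) (<ᵇ-suc a (toℕ x)))

∣interval∣ : ∀ a s → a + s ≤ n → ∣ interval {n} a (a + s) ∣ ≡ s
∣interval∣ {zero}  a       s       a+s≤0       = sym (n≤0⇒n≡0 (≤-trans (m≤n+m s a) a+s≤0))
∣interval∣ {suc n} (suc a) s       (s≤s a+s≤n) =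
  trans (cong ∣_∣ (interval-suc {n} a (a + s))) (∣interval∣ a s a+s≤n)
∣interval∣ {suc n} zero    (suc s) (s≤s s≤n)   = cong suc (∣interval∣ zero s s≤n)
∣interval∣ {suc n} zero    zero    _           = ∣interval∣ {n} zero zero z≤n

∣p∩interval[0,n]∣ : ∀ n (p : Subset (n + m)) → ∣ p ∩ interval 0 n ∣ ≡ ∣ take n p ∣
∣p∩interval[0,n]∣ zero    p             = ∣p∩interval[0,0]∣ p
  where
  ∣p∩interval[0,0]∣ : ∀ {k} (p : Subset k) → ∣ p ∩ interval 0 0 ∣ ≡ 0
  ∣p∩interval[0,0]∣ []            = refl
  ∣p∩interval[0,0]∣ (inside  ∷ p) = ∣p∩interval[0,0]∣ p
  ∣p∩interval[0,0]∣ (outside ∷ p) = ∣p∩interval[0,0]∣ p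
∣p∩interval[0,n]∣ (suc n) (inside  ∷ p) = cong suc (∣p∩interval[0,n]∣ n p)
∣p∩interval[0,n]∣ (suc n) (outside ∷ p) = ∣p∩interval[0,n]∣ n p

∣p∩interval[n+a,n+b]∣ : ∀ n (p : Subset (n + m)) a b →
  ∣ p ∩ interval (n + a) (n + b) ∣ ≡ ∣ drop n p ∩ interval a b ∣
∣p∩interval[n+a,n+b]∣ zero    p       a b = refl
∣p∩interval[n+a,n+b]∣ {m = m} (suc n) (x ∷ p) a b =
  trans (cong (λ I → ∣ (x ∷ p) ∩ I ∣) (interval-suc {n + m} (n + a) (n + b)))
        (trans (cong (λ y → ∣ y ∷ p ∩ interval (n + a) (n + b) ∣) (Bool.∧-zeroʳ x))
               (∣p∩interval[n+a,n+b]∣ n p a b))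

-- Blocks and profiles

∃-inBlock-ℕ : ∀ (ns : Vec ℕ p) k → k < Vec.sum ns →
  ∃[ l ] (psum ns l ≤ k × k < psum ns l + lookup ns l)
∃-inBlock-ℕ (n ∷ ns) k k<Σ with k <? n
... | yes k<n = zero , z≤n , k<n
... | no  k≮n with m≤n⇒∃[o]m+o≡n (≮⇒≥ k≮n)
...   | k′ , refl with ∃-inBlock-ℕ ns k′ (+-cancelˡ-< n k′ _ k<Σ)
...     | l , a≤k′ , k′<a+nₗ =
  suc l , +-monoʳ-≤ n a≤k′ , subst (n + k′ <_) (sym (+-assoc n _ _)) (+-monoʳ-< n k′<a+nₗ)

∃-inBlock : ∀ (ns : Vec ℕ p) (x : Fin (Vec.sum ns)) → ∃[ l ] inBlock ns l x
∃-inBlock ns x = ∃-inBlock-ℕ ns (toℕ x) (Fin.toℕ<n x)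

psum+lookup≤sum : ∀ (ns : Vec ℕ p) l → psum ns l + lookup ns l ≤ Vec.sum ns
psum+lookup≤sum (n ∷ ns) zero    = m≤m+n n _
psum+lookup≤sum (n ∷ ns) (suc l) =
  subst (_≤ n + Vec.sum ns) (sym (+-assoc n _ _)) (+-monoʳ-≤ n (psum+lookup≤sum ns l))

profile : (ns : Vec ℕ p) → Subset (Vec.sum ns) → Vec ℕ p
profile []       G = []
profile (n ∷ ns) G = ∣ take n G ∣ ∷ profile ns (drop n G)

lookup-profile : ∀ (ns : Vec ℕ p) G l → lookup (profile ns G) l ≡ ∣ G ∩ block ns l ∣
lookup-profile (n ∷ ns) G zero    = sym (∣p∩interval[0,n]∣ n G)
lookup-profile (n ∷ ns) G (suc l) = begin
  lookup (profile ns (drop n G)) l                      ≡⟨ lookup-profile ns (drop n G) l ⟩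
  ∣ drop n G ∩ interval a (a + lookup ns l) ∣          ≡⟨ ∣p∩interval[n+a,n+b]∣ n G a _ ⟨
  ∣ G ∩ interval (n + a) (n + (a + lookup ns l)) ∣     ≡⟨ cong (λ b → ∣ G ∩ interval (n + a) b ∣)
                                                               (sym (+-assoc n a _)) ⟩
  ∣ G ∩ block (n ∷ ns) (suc l) ∣                        ∎
  where open ≡-Reasoning
        a = psum ns l

sum-profile : ∀ (ns : Vec ℕ p) G → Vec.sum (profile ns G) ≡ ∣ G ∣
sum-profile []       [] = refl
sum-profile (n ∷ ns) G =
  trans (cong (∣ take n G ∣ +_) (sum-profile ns (drop n G))) (sym (∣p∣≡∣take∣+∣drop∣ n G))

InH2⇒profile∈ : ∀ {ns : Vec ℕ p} {R G} → InH2 ns R G → profile ns G ∈ R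
InH2⇒profile∈ {ns = ns} {G = G} (r , r∈R , ∣G∩X∣≡r) = subst (_∈ _) (sym profile≡r) r∈R
  where
  profile≡r : profile ns G ≡ r
  profile≡r = begin
    profile ns G                      ≡⟨ tabulate∘lookup _ ⟨
    tabulate (lookup (profile ns G))  ≡⟨ tabulate-cong (λ l → trans (lookup-profile ns G l)
                                                                    (∣G∩X∣≡r l)) ⟩
    tabulate (lookup r)               ≡⟨ tabulate∘lookup r ⟩
    r                                 ∎
    where open ≡-Reasoning

∣F∩block∣≤bmax : ∀ {ns : Vec ℕ p} {R F} → InH2 ns R F → ∀ l → ∣ F ∩ block ns l ∣ ≤ bmax R l
∣F∩block∣≤bmax (r , r∈R , ∣F∩X∣≡r) l = ≤-trans (≤-reflexive (∣F∩X∣≡r l)) (lookup≤bmax r∈R)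
  where
  lookup≤bmax : ∀ {R r} → r ∈ R → lookup r l ≤ bmax R l
  lookup≤bmax (here refl) = m≤m⊔n _ _
  lookup≤bmax {R = r′ ∷ _} (there r∈) = ≤-trans (lookup≤bmax r∈) (m≤n⊔m (lookup r′ l) _)

-- Counting subsets

countSubsets : (Subset n → Bool) → ℕ
countSubsets {zero}  f = if f [] then 1 else 0
countSubsets {suc n} f = countSubsets (f ∘ (inside ∷_)) + countSubsets (f ∘ (outside ∷_))

countSubsets-cong : ∀ {f g : Subset n → Bool} → (∀ v → f v ≡ g v) → countSubsets f ≡ countSubsets g
countSubsets-cong {zero}  f≗g = cong (λ b → if b then 1 else 0) (f≗g [])
countSubsets-cong {suc n} f≗g =
  cong₂ _+_ (countSubsets-cong (f≗g ∘ (inside ∷_))) (countSubsets-cong (f≗g ∘ (outside ∷_)))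

countSubsets-false : countSubsets {n} (λ _ → false) ≡ 0
countSubsets-false {zero}  = refl
countSubsets-false {suc n} = cong₂ _+_ (countSubsets-false {n}) (countSubsets-false {n})

countSubsets-take∧drop : ∀ n (f : Subset n → Bool) (g : Subset m → Bool) →
  countSubsets (λ v → f (take n v) ∧ g (drop n v)) ≡ countSubsets f * countSubsets g
countSubsets-take∧drop {m = m} zero f g with f []
... | true  = sym (+-identityʳ _)
... | false = countSubsets-false {m}
countSubsets-take∧drop (suc n) f g =
  trans (cong₂ _+_ (countSubsets-take∧drop n (f ∘ (inside ∷_)) g)
                   (countSubsets-take∧drop n (f ∘ (outside ∷_)) g))
        (sym (*-distribʳ-+ (countSubsets g) (countSubsets (f ∘ (inside ∷_))) _))

countSubsets-∨ : ∀ (f g : Subset n → Bool) → (∀ v → T (f v) → T (g v) → ⊥) →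
  countSubsets (λ v → f v ∨ g v) ≡ countSubsets f + countSubsets g
countSubsets-∨ {zero} f g disjoint with f [] | g [] | disjoint []
... | true  | true  | d = ⊥-elim (d _ _)
... | true  | false | _ = refl
... | false | _     | _ = refl
countSubsets-∨ {suc n} f g disjoint =
  trans (cong₂ _+_ (countSubsets-∨ (f ∘ (inside ∷_)) (g ∘ (inside ∷_)) (disjoint ∘ (inside ∷_)))
                   (countSubsets-∨ (f ∘ (outside ∷_)) (g ∘ (outside ∷_)) (disjoint ∘ (outside ∷_))))
        (interchange (countSubsets (f ∘ (inside ∷_))) (countSubsets (g ∘ (inside ∷_))) _ _)

countSubsets-false-∧ : ∀ (f : Subset n → Bool) → countSubsets (λ v → f v ∧ false) ≡ 0
countSubsets-false-∧ {n} f =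
  trans (countSubsets-cong (λ v → Bool.∧-zeroʳ (f v))) (countSubsets-false {n})

-- Counting the star of a set in H₂

binomShift-≤ : ∀ a b c → c ≤ b → binomShift a b c ≡ (a ∸ c) C (b ∸ c)
binomShift-≤ a b c c≤b rewrite Equivalence.to Bool.T-≡ (≤⇒≤ᵇ c≤b) = refl

binomShift-> : ∀ a b c → b < c → binomShift a b c ≡ 0
binomShift-> a b c b<c with c ≤ᵇ b in c≤ᵇb
... | false = refl
... | true  = contradiction (≤ᵇ⇒≤ c b (subst T (sym c≤ᵇb) _)) (<⇒≱ b<c)

binomShift-suc : ∀ a b c → binomShift (suc a) (suc b) (suc c) ≡ binomShift a b c
binomShift-suc a b c = cong (λ c≤b → if c≤b then (a ∸ c) C (b ∸ c) else 0) (<ᵇ-suc c b)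

binomShift-pascal : ∀ a b c → c ≤ a →
  binomShift a b c + binomShift a (suc b) c ≡ binomShift (suc a) (suc b) c
binomShift-pascal a b c c≤a with c ≤? b
... | yes c≤b
  rewrite binomShift-≤ a b c c≤b | binomShift-≤ a (suc b) c (m≤n⇒m≤1+n c≤b)
        | binomShift-≤ (suc a) (suc b) c (m≤n⇒m≤1+n c≤b) | +-∸-assoc 1 c≤b | +-∸-assoc 1 c≤a
  = nCk+nC[k+1]≡[n+1]C[k+1] (a ∸ c) (b ∸ c)
... | no c≰b with c ≟ suc b
...   | yes refl
  rewrite binomShift-> a b (suc b) (n<1+n b) | binomShift-≤ a (suc b) (suc b) ≤-refl
        | binomShift-≤ (suc a) (suc b) (suc b) ≤-refl | n∸n≡0 b = refl
...   | no c≢1+b with ≤∧≢⇒< (≰⇒> c≰b) (c≢1+b ∘ sym)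
...     | 1+b<c
  rewrite binomShift-> a b c (≰⇒> c≰b) | binomShift-> a (suc b) c 1+b<c
        | binomShift-> (suc a) (suc b) c 1+b<c = refl

countSubsets-size⊇ : ∀ (S : Subset n) r →
  countSubsets (λ v → (∣ v ∣ ≡ᵇ r) ∧ does (S ⊆? v)) ≡ binomShift n r ∣ S ∣
countSubsets-size⊇ []            zero    = refl
countSubsets-size⊇ []            (suc r) = refl
countSubsets-size⊇ {suc n} (inside  ∷ S) zero    =
  cong₂ _+_ (countSubsets-false {n}) (countSubsets-false-∧ {n} (λ v → ∣ v ∣ ≡ᵇ 0))
countSubsets-size⊇ {suc n} (inside  ∷ S) (suc r) = begin
  countSubsets (λ v → (∣ v ∣ ≡ᵇ r) ∧ does (S ⊆? v))
    + countSubsets {n} (λ v → (∣ v ∣ ≡ᵇ suc r) ∧ false)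
    ≡⟨ cong₂ _+_ (countSubsets-size⊇ S r) (countSubsets-false-∧ {n} (λ v → ∣ v ∣ ≡ᵇ suc r)) ⟩
  binomShift n r ∣ S ∣ + 0                 ≡⟨ +-identityʳ _ ⟩
  binomShift n r ∣ S ∣                     ≡⟨ binomShift-suc n r ∣ S ∣ ⟨
  binomShift (suc n) (suc r) (suc ∣ S ∣)   ∎
  where open ≡-Reasoning
countSubsets-size⊇ {suc n} (outside ∷ S) zero    =
  trans (cong₂ _+_ (countSubsets-false {n}) (countSubsets-size⊇ S zero)) (binomShift-0 ∣ S ∣)
  where
  binomShift-0 : ∀ c → binomShift n 0 c ≡ binomShift (suc n) 0 c
  binomShift-0 zero    = refl
  binomShift-0 (suc c) = refl
countSubsets-size⊇ {suc n} (outside ∷ S) (suc r) =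
  trans (cong₂ _+_ (countSubsets-size⊇ S r) (countSubsets-size⊇ S (suc r)))
        (binomShift-pascal n r ∣ S ∣ (∣p∣≤n S))

⊆?-take-drop : ∀ n (p q : Subset (n + m)) →
  does (p ⊆? q) ≡ does (take n p ⊆? take n q) ∧ does (drop n p ⊆? drop n q)
⊆?-take-drop zero    p             q             = refl
⊆?-take-drop (suc n) (outside ∷ p) (_       ∷ q) = ⊆?-take-drop n p q
⊆?-take-drop (suc n) (inside  ∷ p) (outside ∷ q) = refl
⊆?-take-drop (suc n) (inside  ∷ p) (inside  ∷ q) = ⊆?-take-drop n p q

starAtᵇ : (ns r : Vec ℕ p) → Subset (Vec.sum ns) → Subset (Vec.sum ns) → Bool
starAtᵇ []       []       S G = true
starAtᵇ (n ∷ ns) (r ∷ rs) S G =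
  ((∣ take n G ∣ ≡ᵇ r) ∧ does (take n S ⊆? take n G)) ∧ starAtᵇ ns rs (drop n S) (drop n G)

T-starAtᵇ⇒profile≡ : ∀ (ns r : Vec ℕ p) S G → T (starAtᵇ ns r S G) → profile ns G ≡ r
T-starAtᵇ⇒profile≡ []       []       S G _ = refl
T-starAtᵇ⇒profile≡ (n ∷ ns) (r ∷ rs) S G G∈ =
  let G₁∈ , G₂∈ = Equivalence.to Bool.T-∧ G∈
  in cong₂ _∷_ (≡ᵇ⇒≡ _ r (proj₁ (Equivalence.to Bool.T-∧ G₁∈)))
               (T-starAtᵇ⇒profile≡ ns rs (drop n S) (drop n G) G₂∈)

T-starAtᵇ⁺ : ∀ (ns : Vec ℕ p) S G → T (does (S ⊆? G)) → T (starAtᵇ ns (profile ns G) S G)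
T-starAtᵇ⁺ []       S G _    = _
T-starAtᵇ⁺ (n ∷ ns) S G S⊆G =
  let S₁⊆G₁ , S₂⊆G₂ = Equivalence.to Bool.T-∧ (subst T (⊆?-take-drop n S G) S⊆G)
  in Equivalence.from Bool.T-∧
       ( Equivalence.from Bool.T-∧ (≡⇒≡ᵇ ∣ take n G ∣ _ refl , S₁⊆G₁)
       , T-starAtᵇ⁺ ns (drop n S) (drop n G) S₂⊆G₂)

countSubsets-starAt : ∀ (ns r : Vec ℕ p) S → countSubsets (starAtᵇ ns r S) ≡
  product (List.tabulate λ i → binomShift (lookup ns i) (lookup r i) (lookup (profile ns S) i))
countSubsets-starAt []       []       S = refl
countSubsets-starAt (n ∷ ns) (r ∷ rs) S =
  trans (countSubsets-take∧drop n _ _)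
        (cong₂ _*_ (countSubsets-size⊇ (take n S) r) (countSubsets-starAt ns rs (drop n S)))

starᵇ : (ns : Vec ℕ p) → List (Vec ℕ p) → Subset (Vec.sum ns) → Subset (Vec.sum ns) → Bool
starᵇ ns R S G = any (λ r → starAtᵇ ns r S G) R

T-starᵇ⁺ : ∀ {ns : Vec ℕ p} {R S G} → InH2 ns R G → S ⊆ G → T (starᵇ ns R S G)
T-starᵇ⁺ {ns = ns} {R} {S} {G} G∈H₂ S⊆G =
  any⁺ _ (Any.map (λ { refl → T-starAtᵇ⁺ ns S G (T-does⁺ (S ⊆? G) S⊆G) }) (InH2⇒profile∈ G∈H₂))

countSubsets-star : ∀ (ns : Vec ℕ p) {R} → Unique R → ∀ S →
  countSubsets (starᵇ ns R S) ≡ boundTerm ns R (profile ns S)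
countSubsets-star ns []               S = countSubsets-false {Vec.sum ns}
countSubsets-star ns {r ∷ R} (r∉R ∷ R-unique) S =
  trans (countSubsets-∨ (starAtᵇ ns r S) (starᵇ ns R S) disjoint)
        (cong₂ _+_ (countSubsets-starAt ns r S) (countSubsets-star ns R-unique S))
  where
  disjoint : ∀ G → T (starAtᵇ ns r S G) → T (starᵇ ns R S G) → ⊥
  disjoint G G∈r G∈R =
    let r≢r′ , G∈r′ = All.lookupAny r∉R (any⁻ _ R G∈R)
    in r≢r′ (trans (sym (T-starAtᵇ⇒profile≡ ns r S G G∈r)) (T-starAtᵇ⇒profile≡ ns _ S G G∈r′))

-- Duplicate-free families of subsets

tails : Side → List (Subset (suc n)) → List (Subset n)
tails s []             = []
tails s ((x ∷ v) ∷ xs) with x Bool.≟ s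
... | yes _ = v ∷ tails s xs
... | no  _ = tails s xs

length-tails : ∀ (xs : List (Subset (suc n))) →
  length xs ≡ length (tails inside xs) + length (tails outside xs)
length-tails []                  = refl
length-tails ((inside  ∷ v) ∷ xs) = cong suc (length-tails xs)
length-tails ((outside ∷ v) ∷ xs) = trans (cong suc (length-tails xs)) (sym (+-suc _ _))

∈-tails⁻ : ∀ s (xs : List (Subset (suc n))) {v} → v ∈ tails s xs → s ∷ v ∈ xs
∈-tails⁻ s ((x ∷ w) ∷ xs) v∈ with x Bool.≟ s | v∈
... | yes refl | here refl  = here refl
... | yes refl | there v∈′ = there (∈-tails⁻ s xs v∈′)
... | no  _    | v∈′       = there (∈-tails⁻ s xs v∈′)

tails-unique : ∀ s {xs : List (Subset (suc n))} → Unique xs → Unique (tails s xs)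
tails-unique s {[]}           []                = []
tails-unique s {(x ∷ w) ∷ xs} (x∷w∉xs ∷ xs-unique) with x Bool.≟ s
... | yes refl = All.tabulate (λ v∈ w≡v → All.lookup x∷w∉xs (∈-tails⁻ s xs v∈) (cong (s ∷_) w≡v))
               ∷ tails-unique s xs-unique
... | no  _    = tails-unique s xs-unique

length≤countSubsets : ∀ (f : Subset n → Bool) {xs} → Unique xs → (∀ {F} → F ∈ xs → T (f F)) →
  length xs ≤ countSubsets f

length-tails≤countSubsets : ∀ (f : Subset (suc n) → Bool) {xs} → Unique xs →
  (∀ {F} → F ∈ xs → T (f F)) → ∀ s → length (tails s xs) ≤ countSubsets (f ∘ (s ∷_))
length-tails≤countSubsets f {xs} xs-unique xs⊆f s =
  length≤countSubsets (f ∘ (s ∷_)) (tails-unique s xs-unique) (xs⊆f ∘ ∈-tails⁻ s xs)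

length≤countSubsets {zero}  f {[]}          _                 _    = z≤n
length≤countSubsets {zero}  f {[] ∷ []}     _                 xs⊆f with f [] | xs⊆f (here refl)
... | true  | _  = ≤-refl
... | false | ()
length≤countSubsets {zero}  f {[] ∷ [] ∷ _} (([]≢[] ∷ _) ∷ _) _    = contradiction refl []≢[]
length≤countSubsets {suc n} f {xs}          xs-unique         xs⊆f =
  subst (_≤ _) (sym (length-tails xs))
        (+-mono-≤ (length-tails≤countSubsets f xs-unique xs⊆f inside)
                  (length-tails≤countSubsets f xs-unique xs⊆f outside))

≤-≤-+-≡⇒≡ : ∀ {a b c d} → a ≤ c → b ≤ d → a + b ≡ c + d → a ≡ c × b ≡ d
≤-≤-+-≡⇒≡ {a} {b} {c} {d} a≤c b≤d a+b≡c+d =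
  a≡c , +-cancelˡ-≡ c b d (subst (λ x → x + b ≡ c + d) a≡c a+b≡c+d)
  where
  a≡c : a ≡ c
  a≡c = ≤-antisym a≤c (+-cancelʳ-≤ b c a (≤-trans (+-monoʳ-≤ c b≤d) (≤-reflexive (sym a+b≡c+d))))

∈-if-length≡countSubsets : ∀ (f : Subset n → Bool) {xs} → Unique xs → (∀ {F} → F ∈ xs → T (f F)) →
  length xs ≡ countSubsets f → ∀ {G} → T (f G) → G ∈ xs
∈-if-length≡countSubsets {zero}  f {[]}     _ _ 0≡count {[]} fG with f []
... | true = case 0≡count of λ ()
∈-if-length≡countSubsets {zero}  f {[] ∷ _} _ _ _       {[]} _  = here refl
∈-if-length≡countSubsets {suc n} f {xs} xs-unique xs⊆f ∣xs∣≡count {s ∷ v} fG =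
  ∈-tails⁻ s xs (∈-if-length≡countSubsets (f ∘ (s ∷_)) (tails-unique s xs-unique)
                   (xs⊆f ∘ ∈-tails⁻ s xs) (length-tails≡ s) fG)
  where
  length-tails≡ : ∀ s → length (tails s xs) ≡ countSubsets (f ∘ (s ∷_))
  length-tails≡ s = select s (≤-≤-+-≡⇒≡ (length-tails≤countSubsets f xs-unique xs⊆f inside)
                                          (length-tails≤countSubsets f xs-unique xs⊆f outside)
                                          (trans (sym (length-tails xs)) ∣xs∣≡count))
    where
    select : ∀ s → length (tails inside xs) ≡ countSubsets (f ∘ (inside ∷_)) ×
                   length (tails outside xs) ≡ countSubsets (f ∘ (outside ∷_)) →
                   length (tails s xs) ≡ countSubsets (f ∘ (s ∷_))
    select inside  = proj₁
    select outside = proj₂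

-- Shifting

δ≡swap : ∀ {i j} (G : Subset n) → j ∈ₛ G → i ∉ₛ G → δ i j G ≡ (G [ j ]≔ outside) [ i ]≔ inside
δ≡swap {i = i} {j} G j∈G i∉G rewrite []=⇒lookup j∈G | ∉⇒lookup≡outside i∉G = refl

∈-δ⁻ : ∀ {i j x} {G : Subset n} → j ∈ₛ G → i ∉ₛ G → x ≢ i → x ∈ₛ δ i j G → x ∈ₛ G [ j ]≔ outside
∈-δ⁻ {G = G} j∈G i∉G x≢i x∈δG = ∈-[]≔⁻ x≢i (subst (_ ∈ₛ_) (δ≡swap G j∈G i∉G) x∈δG)

module _ {n} {𝓕 : List (Subset n)} {A : Subset n}
         (exchange : ∀ {F G j} → F ∈ 𝓕 → G ∈ 𝓕 → j ∈ₛ F → j ∈ₛ G → j ∉ₛ A →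
                     ∃[ G′ ] (G′ ∈ 𝓕 × G′ ∩ F ⊆ G × j ∉ₛ G′)) where

  trace⊆members : ∀ {F₀} → F₀ ∈ 𝓕 → (∀ {G} → G ∈ 𝓕 → ∣ F₀ ∩ A ∣ ≤ ∣ G ∩ F₀ ∣) →
    ∀ {G} → G ∈ 𝓕 → F₀ ∩ A ⊆ G
  trace⊆members {F₀} F₀∈𝓕 F₀∩A-small G∈𝓕 = <-rec P step _ G∈𝓕 refl
    where
    D = F₀ ∩ ∁ (A)

    P : ℕ → Set
    P k = ∀ {G} → G ∈ 𝓕 → ∣ G ∩ D ∣ ≡ k → F₀ ∩ A ⊆ G

    step : ∀ k → (∀ {k′} → k′ < k → P k′) → P k
    step _ rec {G} G∈𝓕 refl with nonempty? (G ∩ D)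
    ... | yes (j , j∈G∩D)
      with j∈G , j∈D ← x∈p∩q⁻ G D j∈G∩D
      with j∈F₀ , j∈∁A ← x∈p∩q⁻ F₀ (∁ A) j∈D
      with G′ , G′∈𝓕 , G′∩F₀⊆G , j∉G′ ← exchange F₀∈𝓕 G∈𝓕 j∈F₀ j∈G (x∈∁p⇒x∉p j∈∁A)
      = λ x∈F₀∩A → G′∩F₀⊆G (x∈p∩q⁺ ( rec ∣G′∩D∣<∣G∩D∣ G′∈𝓕 refl x∈F₀∩A
                                    , proj₁ (x∈p∩q⁻ F₀ A x∈F₀∩A)))
      where
      ∣G′∩D∣<∣G∩D∣ : ∣ G′ ∩ D ∣ < ∣ G ∩ D ∣
      ∣G′∩D∣<∣G∩D∣ = p⊂q⇒∣p∣<∣q∣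
        ( (λ x∈ → let x∈G′ , x∈D = x∈p∩q⁻ G′ D x∈ in
                  x∈p∩q⁺ (G′∩F₀⊆G (x∈p∩q⁺ (x∈G′ , proj₁ (x∈p∩q⁻ F₀ _ x∈D))) , x∈D))
        , j , j∈G∩D , j∉G′ ∘ proj₁ ∘ x∈p∩q⁻ G′ D)
    ... | no G∩D-empty = ∣q∣≤∣p∩q∣⇒q⊆p (begin
      ∣ F₀ ∩ A ∣                           ≤⟨ F₀∩A-small G∈𝓕 ⟩
      ∣ G ∩ F₀ ∣                           ≡⟨ ∣p∣≡∣p∩q∣+∣p∩∁q∣ (G ∩ F₀) A ⟩
      ∣ (G ∩ F₀) ∩ A ∣ + ∣ (G ∩ F₀) ∩ ∁ A ∣ ≡⟨ cong₂ (λ X Y → ∣ X ∣ + ∣ Y ∣) (∩-assoc G F₀ A)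
                                                                            (∩-assoc G F₀ (∁ A)) ⟩
      ∣ G ∩ (F₀ ∩ A) ∣ + ∣ G ∩ D ∣         ≡⟨ cong (∣ G ∩ (F₀ ∩ A) ∣ +_) ∣G∩D∣≡0 ⟩
      ∣ G ∩ (F₀ ∩ A) ∣ + 0                 ≡⟨ +-identityʳ _ ⟩
      ∣ G ∩ (F₀ ∩ A) ∣                     ∎)
      where
      open ≤-Reasoning
      ∣G∩D∣≡0 : ∣ G ∩ D ∣ ≡ 0
      ∣G∩D∣≡0 = trans (cong ∣_∣ (Empty-unique G∩D-empty)) (∣⊥∣≡0 n)

positive-remainder : ∀ {b q r z} → suc q ≤ b → suc r ≤ b → 2 * b ∸ 1 ≤ q + r + z → 0 < z
positive-remainder {z = suc z} _ _ _ = z<s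
positive-remainder {b} {q} {r} {zero} q<b r<b 2b-1≤q+r = ⊥-elim (<-irrefl refl (begin-strict
  q + r          <⟨ ∸-monoˡ-≤ 1 2+q+r≤2b ⟩
  2 * b ∸ 1      ≤⟨ 2b-1≤q+r ⟩
  q + r + 0      ≡⟨ +-identityʳ (q + r) ⟩
  q + r          ∎))
  where
  open ≤-Reasoning
  2+q+r≤2b : suc (suc (q + r)) ≤ 2 * b
  2+q+r≤2b = begin
    suc (suc (q + r)) ≡⟨ cong suc (+-suc q r) ⟨
    suc q + suc r     ≤⟨ +-mono-≤ q<b r<b ⟩
    b + b             ≡⟨ cong (b +_) (+-identityʳ b) ⟨
    2 * b             ∎

module _ (ns : Vec ℕ p) (R : List (Vec ℕ p)) (Q-fits : ∀ l → 2 * bmax R l ∸ 1 ≤ lookup ns l) where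

  Qₗ : Fin p → Subset (Vec.sum ns)
  Qₗ l = Q ns l (2 * bmax R l ∸ 1)

  Qₗ⊆block : ∀ l → Qₗ l ⊆ block ns l
  Qₗ⊆block l = interval-⊆ (psum ns l) (+-monoʳ-≤ (psum ns l) (Q-fits l))

  Qₗ⊆K : ∀ l → Qₗ l ⊆ K ns R
  Qₗ⊆K l = ⊆-⋃ (∈-map⁺ Qₗ (∈-allFin l))

  ∣Qₗ∣ : ∀ l → ∣ Qₗ l ∣ ≡ 2 * bmax R l ∸ 1
  ∣Qₗ∣ l = ∣interval∣ (psum ns l) _
    (≤-trans (+-monoʳ-≤ (psum ns l) (Q-fits l)) (psum+lookup≤sum ns l))

  1+∣Qₗ∩F∣≤bmax : ∀ {F j l} → InH2 ns R F → j ∈ₛ F → j ∈ₛ block ns l → j ∉ₛ K ns R →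
    suc ∣ Qₗ l ∩ F ∣ ≤ bmax R l
  1+∣Qₗ∩F∣≤bmax {F} {j} {l} F∈H₂ j∈F j∈Xₗ j∉K =
    ≤-trans (p⊂q⇒∣p∣<∣q∣ Qₗ∩F⊂F∩Xₗ) (∣F∩block∣≤bmax {ns = ns} {R} {F} F∈H₂ l)
    where
    Qₗ∩F⊂F∩Xₗ : Qₗ l ∩ F ⊂ F ∩ block ns l
    Qₗ∩F⊂F∩Xₗ =
      (λ x∈ → let x∈Qₗ , x∈F = x∈p∩q⁻ _ _ x∈ in x∈p∩q⁺ (x∈F , Qₗ⊆block l x∈Qₗ)) ,
      j , x∈p∩q⁺ (j∈F , j∈Xₗ) , j∉K ∘ Qₗ⊆K l ∘ proj₁ ∘ x∈p∩q⁻ _ _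

  ∃-Qₗ-avoiding : ∀ {A B j l} → InH2 ns R A → InH2 ns R B → j ∈ₛ A → j ∈ₛ B →
    j ∈ₛ block ns l → j ∉ₛ K ns R → ∃[ i ] (i ∈ₛ Qₗ l × i ∉ₛ A × i ∉ₛ B)
  ∃-Qₗ-avoiding {A} {B} {j} {l} A∈H₂ B∈H₂ j∈A j∈B j∈Xₗ j∉K =
    let i , i∈ = 0<∣p∣⇒Nonempty 0<∣Qₗ∖A∪B∣
        i∈Qₗ , i∈∁A∪B = x∈p∩q⁻ (Qₗ l) (∁ (A ∪ B)) i∈
    in i , i∈Qₗ , x∈∁p⇒x∉p i∈∁A∪B ∘ x∈p∪q⁺ ∘ inj₁ , x∈∁p⇒x∉p i∈∁A∪B ∘ x∈p∪q⁺ ∘ inj₂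
    where
    _∖A∪B : Subset (Vec.sum ns) → Subset (Vec.sum ns)
    X ∖A∪B = X ∩ ∁ (A ∪ B)

    0<∣Qₗ∖A∪B∣ : 0 < ∣ Qₗ l ∖A∪B ∣
    0<∣Qₗ∖A∪B∣ = positive-remainder
      (1+∣Qₗ∩F∣≤bmax A∈H₂ j∈A j∈Xₗ j∉K) (1+∣Qₗ∩F∣≤bmax B∈H₂ j∈B j∈Xₗ j∉K) (begin
        2 * bmax R l ∸ 1                               ≡⟨ ∣Qₗ∣ l ⟨
        ∣ Qₗ l ∣                                       ≡⟨ ∣p∣≡∣p∩q∣+∣p∩∁q∣ (Qₗ l) (A ∪ B) ⟩
        ∣ Qₗ l ∩ (A ∪ B) ∣ + ∣ Qₗ l ∖A∪B ∣             ≡⟨ cong (λ X → ∣ X ∣ + ∣ Qₗ l ∖A∪B ∣)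
                                                                (∩-distribˡ-∪ (Qₗ l) A B) ⟩
        ∣ Qₗ l ∩ A ∪ Qₗ l ∩ B ∣ + ∣ Qₗ l ∖A∪B ∣        ≤⟨ +-monoˡ-≤ _ (∣p∪q∣≤∣p∣+∣q∣ (Qₗ l ∩ A) _) ⟩
        ∣ Qₗ l ∩ A ∣ + ∣ Qₗ l ∩ B ∣ + ∣ Qₗ l ∖A∪B ∣    ∎)
      where open ≤-Reasoning

module _ (ns : Vec ℕ p) (R : List (Vec ℕ p)) (𝓕 : List (Subset (Vec.sum ns)))
         (Q-fits : ∀ l → 2 * bmax R l ∸ 1 ≤ lookup ns l)
         (𝓕⊆H₂ : ∀ {F} → F ∈ 𝓕 → InH2 ns R F)
         (shifted : ∀ l → LShifted ns l 𝓕) where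

  shift-exchange : ∀ {F₀ G j} → F₀ ∈ 𝓕 → G ∈ 𝓕 → j ∈ₛ F₀ → j ∈ₛ G → j ∉ₛ K ns R →
    ∃[ G′ ] (G′ ∈ 𝓕 × G′ ∩ F₀ ⊆ G × j ∉ₛ G′)
  shift-exchange {F₀} {G} {j} F₀∈𝓕 G∈𝓕 j∈F₀ j∈G j∉K
    with l , psumₗ≤j , j<psumₗ+nₗ ← ∃-inBlock ns j
    with i , i∈Qₗ , i∉F₀ , i∉G ← ∃-Qₗ-avoiding ns R Q-fits {l = l} (𝓕⊆H₂ F₀∈𝓕) (𝓕⊆H₂ G∈𝓕)
                                   j∈F₀ j∈G (∈-interval⁺ (psum ns l) _ psumₗ≤j j<psumₗ+nₗ) j∉K
    = δ i j G , δG∈𝓕 , δG∩F₀⊆G , j∉δG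
    where
    s = 2 * bmax R l ∸ 1

    i<j : toℕ i < toℕ j
    i<j = <-≤-trans (proj₂ (∈-interval⁻ (psum ns l) (psum ns l + s) i∈Qₗ))
                    (≮⇒≥ (j∉K ∘ Qₗ⊆K ns R Q-fits l
                              ∘ ∈-interval⁺ (psum ns l) (psum ns l + s) psumₗ≤j))

    δG∈𝓕 : δ i j G ∈ 𝓕
    δG∈𝓕 = Equivalence.to
      (shifted l i j (∈-interval⁻ (psum ns l) _ (Qₗ⊆block ns R Q-fits l i∈Qₗ))
                     (psumₗ≤j , j<psumₗ+nₗ) i<j (δ i j G))
      (inj₁ (G , G∈𝓕 , refl))

    δG∩F₀⊆G : δ i j G ∩ F₀ ⊆ G
    δG∩F₀⊆G x∈ = let x∈δG , x∈F₀ = x∈p∩q⁻ (δ i j G) F₀ x∈ in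
      ∈-[]≔outside⁻ (∈-δ⁻ j∈G i∉G (λ { refl → i∉F₀ x∈F₀ }) x∈δG)

    j∉δG : j ∉ₛ δ i j G
    j∉δG j∈δG = ∉-[]≔outside (∈-δ⁻ j∈G i∉G (λ j≡i → <-irrefl (cong toℕ (sym j≡i)) i<j) j∈δG)

foldr-⊓-attained : ∀ {A : Set} (f : A → ℕ) x xs →
  ∃[ y ] (y ∈ x ∷ xs × f y ≡ foldr (λ z m → f z ⊓ m) (f x) xs)
foldr-⊓-attained f x []       = x , here refl , refl
foldr-⊓-attained f x (y ∷ ys) with ⊓-sel (f y) (foldr (λ z m → f z ⊓ m) (f x) ys)
... | inj₁ fy⊓m≡fy = y , there (here refl) , sym fy⊓m≡fy
... | inj₂ fy⊓m≡m with foldr-⊓-attained f x ys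
...   | z , here refl , fz≡m = z , here refl , trans fz≡m (sym fy⊓m≡m)
...   | z , there z∈ys , fz≡m = z , there (there z∈ys) , trans fz≡m (sym fy⊓m≡m)

alpha-attained : ∀ (ns : Vec ℕ p) R (𝓕 : List (Subset (Vec.sum ns))) → 𝓕 ≢ [] →
  ∃[ F ] (F ∈ 𝓕 × ∣ F ∩ K ns R ∣ ≡ alpha ns R 𝓕)
alpha-attained ns R []      𝓕≢[] = contradiction refl 𝓕≢[]
alpha-attained ns R (F ∷ 𝓕) _    = foldr-⊓-attained (λ G → ∣ G ∩ K ns R ∣) F 𝓕

lemma3p1 : (p t : ℕ) → 1 ≤ p → 1 ≤ t →
    (ns : Vec ℕ p) → (∀ i → 1 ≤ lookup ns i) →
    (R : List (Vec ℕ p)) → Unique R → R ≢ [] →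
    (∀ {r} → r ∈ R → ∀ i → 1 ≤ lookup r i) →
    (∀ i → 2 * (t + 1) * bmax R i < lookup ns i) →
    (𝓕 : List (Subset (Vec.sum ns))) → Unique 𝓕 → 𝓕 ≢ [] →
    (∀ {F} → F ∈ 𝓕 → InH2 ns R F) →
    TIntersecting t 𝓕 →
    (∀ l → LShifted ns l 𝓕) →
    alpha ns R 𝓕 ≡ t →
    (M : ℕ) → IsMaxBound ns R t M →
    (length 𝓕 ≤ M) × (length 𝓕 ≡ M → FullStar ns R t 𝓕)
lemma3p1 p t _ _ ns _ R R-unique _ _ ns-large 𝓕 𝓕-unique 𝓕≢[] 𝓕⊆H₂ t-intersecting shifted α≡t
         M (_ , M-max)
  with F₀ , F₀∈𝓕 , ∣F₀∩K∣≡α ← alpha-attained ns R 𝓕 𝓕≢[] =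
  ≤-trans ∣𝓕∣≤∣star∣ ∣star∣≤M ,
  λ ∣𝓕∣≡M → T₀ , ∣T₀∣≡t , λ G → mk⇔
    (λ G∈𝓕 → 𝓕⊆H₂ G∈𝓕 , λ {x} → T₀⊆ G∈𝓕 {x})
    (Product.uncurry (star⊆𝓕 ∣𝓕∣≡M))
  where
  T₀ : Subset (Vec.sum ns)
  T₀ = F₀ ∩ K ns R

  ∣T₀∣≡t : ∣ T₀ ∣ ≡ t
  ∣T₀∣≡t = trans ∣F₀∩K∣≡α α≡t

  -- Only this consequence of n_l > 2(t+1)b_l is needed, and none of the positivity hypotheses.
  Q-fits : ∀ l → 2 * bmax R l ∸ 1 ≤ lookup ns l
  Q-fits l = ≤-trans (m∸n≤m _ 1)
    (≤-trans (*-monoˡ-≤ (bmax R l) (*-monoʳ-≤ 2 (m≤n+m 1 t))) (<⇒≤ (ns-large l)))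

  T₀⊆ : ∀ {G} → G ∈ 𝓕 → T₀ ⊆ G
  T₀⊆ = trace⊆members (shift-exchange ns R 𝓕 Q-fits 𝓕⊆H₂ shifted) F₀∈𝓕
          (λ G∈𝓕 → subst (_≤ _) (sym ∣T₀∣≡t) (t-intersecting G∈𝓕 F₀∈𝓕))

  𝓕⊆star : ∀ {G} → G ∈ 𝓕 → T (starᵇ ns R T₀ G)
  𝓕⊆star G∈𝓕 = T-starᵇ⁺ {ns = ns} (𝓕⊆H₂ G∈𝓕) (T₀⊆ G∈𝓕)

  ∣𝓕∣≤∣star∣ : length 𝓕 ≤ countSubsets (starᵇ ns R T₀)
  ∣𝓕∣≤∣star∣ = length≤countSubsets (starᵇ ns R T₀) 𝓕-unique 𝓕⊆star

  ∣star∣≤M : countSubsets (starᵇ ns R T₀) ≤ M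
  ∣star∣≤M = subst (_≤ M) (sym (countSubsets-star ns R-unique T₀))
                   (M-max (profile ns T₀) (trans (sum-profile ns T₀) ∣T₀∣≡t))

  star⊆𝓕 : length 𝓕 ≡ M → ∀ {G} → InH2 ns R G → T₀ ⊆ G → G ∈ 𝓕
  star⊆𝓕 ∣𝓕∣≡M G∈H₂ T₀⊆G = ∈-if-length≡countSubsets (starᵇ ns R T₀) 𝓕-unique 𝓕⊆star
    (≤-antisym ∣𝓕∣≤∣star∣ (subst (countSubsets (starᵇ ns R T₀) ≤_) (sym ∣𝓕∣≡M) ∣star∣≤M))
    (T-starᵇ⁺ {ns = ns} G∈H₂ T₀⊆G)
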